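{- Let $(G, \mathbf{A}(G), \mathbf{B}(G), T, k)$ be an instance of \textsc{Bipartite Steiner $T$-join}. Let $X \subseteq T$ be a maximal set such that $N_G(x) = N_G(y)$ for all $x, y \in X$. Let $(G', \mathbf{A}(G'), \mathbf{B}(G'), T', k)$ be obtained by removing all but $2 - (|X| \bmod 2)$ vertices of $X$ from the graph and from $T$. Then $(G', \mathbf{A}(G'), \mathbf{B}(G'), T', k)$ has a solution if and only if $(G, \mathbf{A}(G), \mathbf{B}(G), T, k)$ has a solution.
   Context: An instance of \textsc{Bipartite Steiner $T$-join} consists of a connected bipartite graph $G$ with bipartition $V(G) = \mathbf{A}(G) \uplus \mathbf{B}(G)$, a set $T \subseteq \mathbf{A}(G)$ of terminals and an integer $k$. A solution is a set $C \subseteq \mathbf{B}(G)$ with $|C| \le k$ such that every connected component of $G[C \cup \mathbf{A}(G)]$ contains an even number of vertices of $T$. $N_G(x)$ is the open neighborhood of $x$. -}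

module Defs where

open import Data.Bool using (Bool; true; false)
open import Data.Nat using (ℕ; _≤_; _%_; _∸_; _⊓_)
open import Data.Nat.Properties using ()
open import Data.Nat.Divisibility using (_∣_)
open import Data.Fin using (Fin)
open import Data.Fin.Subset using (Subset; _∈_; _∉_; _⊆_; _∪_; _∩_; _─_; ∣_∣; ⊤; Nonempty)
open import Data.Product using (_×_; Σ; ∃)
open import Data.Sum using (_⊎_)
open import Relation.Binary.PropositionalEquality using (_≡_)
open import Relation.Nullary using (¬_)

record Graph (n : ℕ) : Set where
  field
    adj    : Fin n → Fin n → Bool
    adj-sym : ∀ u v → adj u v ≡ adj v u
    adj-irrefl : ∀ v → adj v v ≡ false
open Graph public

module _ {n : ℕ} (G : Graph n) where

  Edge : Fin n → Fin n → Set
  Edge u v = adj G u v ≡ true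

  data Walk (R : Subset n) : Fin n → Fin n → Set where
    here : ∀ {v} → v ∈ R → Walk R v v
    step : ∀ {u w v} → u ∈ R → Edge u w → Walk R w v → Walk R u v

  Connected : Subset n → Set
  Connected R = ∀ u v → u ∈ R → v ∈ R → Walk R u v

  IsComponent : Subset n → Subset n → Set
  IsComponent S R =
    R ⊆ S × Nonempty R × Connected R ×
    (∀ R' → R ⊆ R' → R' ⊆ S → Connected R' → R' ⊆ R)

  SameNbhd : Fin n → Fin n → Set
  SameNbhd x y = ∀ z → adj G x z ≡ adj G y z

  -- (G, A, B, T, k) is an instance of Bipartite Steiner T-join
  -- (vertex set of G is all of Fin n).
  IsInstance : Subset n → Subset n → Subset n → Set
  IsInstance A B T =
    (∀ v → v ∈ A ⊎ v ∈ B) ×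
    (∀ v → v ∈ A → v ∉ B) ×
    (∀ u v → Edge u v → u ∈ A → v ∈ B) ×
    (∀ u v → Edge u v → u ∈ B → v ∈ A) ×
    Connected ⊤ ×
    T ⊆ A

  -- C is a solution: C ⊆ B, |C| ≤ k, and every connected component of
  -- G[C ∪ A] contains an even number of vertices of T.
  -- (A, B, T are the sides/terminals of the (possibly vertex-deleted) instance;
  --  vertices outside A ∪ B are regarded as deleted.)
  IsSolution : Subset n → Subset n → Subset n → ℕ → Subset n → Set
  IsSolution A B T k C =
    C ⊆ B × ∣ C ∣ ≤ k ×
    (∀ R → IsComponent (C ∪ A) R → 2 ∣ ∣ R ∩ T ∣)

  HasSolution : Subset n → Subset n → Subset n → ℕ → Set
  HasSolution A B T k = ∃ λ C → IsSolution A B T k C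

  Twins : Subset n → Set
  Twins X = ∀ x y → x ∈ X → y ∈ X → SameNbhd x y

  MaximalTwinSet : Subset n → Subset n → Set
  MaximalTwinSet T X =
    X ⊆ T × Twins X × (∀ X' → X ⊆ X' → X' ⊆ T → Twins X' → X' ⊆ X)

-- number of vertices of X that are kept: 2 - (|X| mod 2), capped by |X|
-- (if X = ∅ nothing can be kept or removed).
keepCount : ℕ → ℕ
keepCount m = m ⊓ (2 ∸ (m % 2))

module Submission where

-- Let D = X ─ Y be the removed twins and y ∈ Y a kept one; |D| is even by the
-- choice of keepCount.  For a fixed C ⊆ B put S = C ∪ A.  If every component of
-- G[S] (or of G[S ─ D]) has evenly many terminals, the terminal y is not
-- isolated there, so it has a neighbour c, which is then a common neighbour of
-- all of D.  Hence a component of G[S] either avoids D or contains all of D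
-- together with y, and R ↦ R ─ D maps the components of G[S] onto those of
-- G[S ─ D] (identify D with y to transport walks).  Since
-- |R ∩ T| = |R ∩ D| + |(R ─ D) ∩ (T ─ D)| with |R ∩ D| ∈ {0, |D|} even,
-- parity transfers in both directions.

open import Defs
open import Data.Bool using (true)
import Data.Bool as Bool
open import Data.Nat using (ℕ; zero; suc; _+_; _%_; _/_; s≤s)
open import Data.Nat.Properties using (+-suc; ⊓-zeroʳ; suc-injective)
open import Data.Nat.DivMod using (m≡m%n+[m/n]*n; m%n<n)
open import Data.Nat.Divisibility using (_∣_; divides; ∣1⇒≡1; ∣m+n∣m⇒∣n; ∣m∣n⇒∣m+n)
open import Data.Fin using (Fin; zero; suc)
open import Data.Fin.Properties using (any?)
open import Data.Vec using ([]; _∷_; here; there)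
open import Data.Fin.Subset
open import Data.Fin.Subset.Properties
open import Data.Product using (_×_; ∃; _,_; proj₁; proj₂)
open import Data.Sum using (inj₁; inj₂)
open import Data.Empty using (⊥-elim)
open import Function using (id; _∘_)
open import Function.Bundles using (_⇔_; mk⇔; Equivalence)
open import Relation.Binary.PropositionalEquality
open import Relation.Nullary using (¬_; yes; no)
open import Relation.Nullary.Decidable using (_×-dec_)

-- Keeping keepCount m of m elements removes an even number of them: for
-- m = 2 + m' one keeps 2 if m' is even and 1 if m' is odd.
keepCount-complement-even : ∀ m d → m ≡ keepCount m + d → 2 ∣ d
keepCount-complement-even zero d m≡ = divides 0 (sym m≡)
keepCount-complement-even (suc zero) d m≡ = divides 0 (sym (suc-injective m≡))
keepCount-complement-even (suc (suc m)) d m≡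
  with m % 2 | m%n<n m 2 | m≡m%n+[m/n]*n m 2
... | zero | _ | m≡2q rewrite ⊓-zeroʳ m =
  divides (m / 2) (trans (sym (suc-injective (suc-injective m≡))) m≡2q)
... | suc zero | _ | m≡1+2q =
  divides (suc (m / 2)) (trans (sym (suc-injective m≡)) (cong suc m≡1+2q))
... | suc (suc _) | s≤s (s≤s ()) | _

keepCount≡0⇒≡0 : ∀ m → keepCount m ≡ 0 → m ≡ 0
keepCount≡0⇒≡0 zero _ = refl
keepCount≡0⇒≡0 (suc m) k≡0 with suc m % 2 | m%n<n (suc m) 2
... | zero | _ with () ← k≡0
... | suc zero | _ with () ← k≡0
... | suc (suc _) | s≤s (s≤s ())

x∈p─q⁻ : ∀ {n} {x : Fin n} (p q : Subset n) → x ∈ p ─ q → x ∈ p × x ∉ q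
x∈p─q⁻ (inside ∷ p) (outside ∷ q) here = here , λ ()
x∈p─q⁻ (s ∷ p) (t ∷ q) (there x∈p─q) with x∈p─q⁻ p q x∈p─q
... | x∈p , x∉q = there x∈p , λ x∈t∷q → x∉q (drop-there x∈t∷q)
x∈p─q⁻ {x = zero} (outside ∷ p) (inside ∷ q) ()
x∈p─q⁻ {x = zero} (outside ∷ p) (outside ∷ q) ()

∣p∣≡∣p∩q∣+∣p─q∣ : ∀ {n} (p q : Subset n) → ∣ p ∣ ≡ ∣ p ∩ q ∣ + ∣ p ─ q ∣
∣p∣≡∣p∩q∣+∣p─q∣ [] [] = refl
∣p∣≡∣p∩q∣+∣p─q∣ (inside ∷ p) (inside ∷ q) = cong suc (∣p∣≡∣p∩q∣+∣p─q∣ p q)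
∣p∣≡∣p∩q∣+∣p─q∣ (inside ∷ p) (outside ∷ q) =
  trans (cong suc (∣p∣≡∣p∩q∣+∣p─q∣ p q)) (sym (+-suc ∣ p ∩ q ∣ ∣ p ─ q ∣))
∣p∣≡∣p∩q∣+∣p─q∣ (outside ∷ p) (inside ∷ q) = ∣p∣≡∣p∩q∣+∣p─q∣ p q
∣p∣≡∣p∩q∣+∣p─q∣ (outside ∷ p) (outside ∷ q) = ∣p∣≡∣p∩q∣+∣p─q∣ p q

∣p∣≡0⇒Empty : ∀ {n} (p : Subset n) → ∣ p ∣ ≡ 0 → Empty p
∣p∣≡0⇒Empty (outside ∷ p) ∣p∣≡0 (suc x , there x∈p) = ∣p∣≡0⇒Empty p ∣p∣≡0 (x , x∈p)

q⊆p⇒p∩q≡q : ∀ {n} {p q : Subset n} → q ⊆ p → p ∩ q ≡ q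
q⊆p⇒p∩q≡q {p = p} {q} q⊆p =
  ⊆-antisym (λ x∈p∩q → proj₂ (x∈p∩q⁻ p q x∈p∩q)) (λ x∈q → x∈p∩q⁺ (q⊆p x∈q , x∈q))

[p∩q]─r≡[p─r]∩[q─r] : ∀ {n} (p q r : Subset n) → (p ∩ q) ─ r ≡ (p ─ r) ∩ (q ─ r)
[p∩q]─r≡[p─r]∩[q─r] p q r = ⊆-antisym to from
  where
  to : (p ∩ q) ─ r ⊆ (p ─ r) ∩ (q ─ r)
  to x∈ with x∈p─q⁻ (p ∩ q) r x∈
  ... | x∈p∩q , x∉r with x∈p∩q⁻ p q x∈p∩q
  ... | x∈p , x∈q = x∈p∩q⁺ (x∈p∧x∉q⇒x∈p─q x∈p x∉r , x∈p∧x∉q⇒x∈p─q x∈q x∉r)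
  from : (p ─ r) ∩ (q ─ r) ⊆ (p ∩ q) ─ r
  from x∈ with x∈p∩q⁻ (p ─ r) (q ─ r) x∈
  ... | x∈p─r , x∈q─r with x∈p─q⁻ p r x∈p─r
  ... | x∈p , x∉r = x∈p∧x∉q⇒x∈p─q (x∈p∩q⁺ (x∈p , proj₁ (x∈p─q⁻ q r x∈q─r))) x∉r

disjoint⇒p─q≡p : ∀ {n} {p q : Subset n} → (∀ {x} → x ∈ p → x ∉ q) → p ─ q ≡ p
disjoint⇒p─q≡p {p = p} {q} p∩q≡∅ =
  ⊆-antisym (p─q⊆p p q) (λ x∈p → x∈p∧x∉q⇒x∈p─q x∈p (p∩q≡∅ x∈p))

[p∪q]─q≡p─q : ∀ {n} (p q : Subset n) → (p ∪ q) ─ q ≡ p ─ q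
[p∪q]─q≡p─q p q = ⊆-antisym to from
  where
  to : (p ∪ q) ─ q ⊆ p ─ q
  to x∈ with x∈p─q⁻ (p ∪ q) q x∈
  ... | x∈p∪q , x∉q with x∈p∪q⁻ p q x∈p∪q
  ... | inj₁ x∈p = x∈p∧x∉q⇒x∈p─q x∈p x∉q
  ... | inj₂ x∈q = ⊥-elim (x∉q x∈q)
  from : p ─ q ⊆ (p ∪ q) ─ q
  from x∈ with x∈p─q⁻ p q x∈
  ... | x∈p , x∉q = x∈p∧x∉q⇒x∈p─q (x∈p∪q⁺ (inj₁ x∈p)) x∉q

disjoint⇒p∪[q─r]≡[p∪q]─r : ∀ {n} {p q r : Subset n} → (∀ {x} → x ∈ p → x ∉ r) →
                          p ∪ (q ─ r) ≡ (p ∪ q) ─ r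
disjoint⇒p∪[q─r]≡[p∪q]─r {p = p} {q} {r} p∩r≡∅ = ⊆-antisym to from
  where
  to : p ∪ (q ─ r) ⊆ (p ∪ q) ─ r
  to x∈ with x∈p∪q⁻ p (q ─ r) x∈
  ... | inj₁ x∈p = x∈p∧x∉q⇒x∈p─q (x∈p∪q⁺ (inj₁ x∈p)) (p∩r≡∅ x∈p)
  ... | inj₂ x∈q─r = x∈p∧x∉q⇒x∈p─q (x∈p∪q⁺ (inj₂ (proj₁ (x∈p─q⁻ q r x∈q─r))))
                                     (proj₂ (x∈p─q⁻ q r x∈q─r))
  from : (p ∪ q) ─ r ⊆ p ∪ (q ─ r)
  from x∈ with x∈p─q⁻ (p ∪ q) r x∈
  ... | x∈p∪q , x∉r with x∈p∪q⁻ p q x∈p∪q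
  ... | inj₁ x∈p = x∈p∪q⁺ (inj₁ x∈p)
  ... | inj₂ x∈q = x∈p∪q⁺ (inj₂ (x∈p∧x∉q⇒x∈p─q x∈q x∉r))

terminals-split : ∀ {n} (R T D : Subset n) → D ⊆ T →
                  ∣ R ∩ T ∣ ≡ ∣ R ∩ D ∣ + ∣ (R ─ D) ∩ (T ─ D) ∣
terminals-split R T D D⊆T = begin
  ∣ R ∩ T ∣                           ≡⟨ ∣p∣≡∣p∩q∣+∣p─q∣ (R ∩ T) D ⟩
  ∣ (R ∩ T) ∩ D ∣ + ∣ (R ∩ T) ─ D ∣   ≡⟨ cong₂ (λ P Q → ∣ P ∣ + ∣ Q ∣) removed kept ⟩
  ∣ R ∩ D ∣ + ∣ (R ─ D) ∩ (T ─ D) ∣   ∎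
  where
  open ≡-Reasoning
  removed : (R ∩ T) ∩ D ≡ R ∩ D
  removed = trans (∩-assoc R T D) (cong (R ∩_) (q⊆p⇒p∩q≡q D⊆T))
  kept : (R ∩ T) ─ D ≡ (R ─ D) ∩ (T ─ D)
  kept = [p∩q]─r≡[p─r]∩[q─r] R T D

module GraphFacts {n : ℕ} (G : Graph n) where

  Edge-sym : ∀ {u v} → Edge G u v → Edge G v u
  Edge-sym {u} {v} u~v = trans (adj-sym G v u) u~v

  walk-start : ∀ {R u v} → Walk G R u v → u ∈ R
  walk-start (here u∈R) = u∈R
  walk-start (step u∈R _ _) = u∈R

  walk-mono : ∀ {R R' u v} → R ⊆ R' → Walk G R u v → Walk G R' u v
  walk-mono R⊆R' (here u∈R) = here (R⊆R' u∈R)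
  walk-mono R⊆R' (step u∈R u~w w⇝v) = step (R⊆R' u∈R) u~w (walk-mono R⊆R' w⇝v)

  _++ʷ_ : ∀ {R u v w} → Walk G R u v → Walk G R v w → Walk G R u w
  here _ ++ʷ q = q
  step u∈R u~x p ++ʷ q = step u∈R u~x (p ++ʷ q)

  walk-reverse : ∀ {R u v} → Walk G R u v → Walk G R v u
  walk-reverse (here u∈R) = here u∈R
  walk-reverse (step u∈R u~w w⇝v) =
    walk-reverse w⇝v ++ʷ step (walk-start w⇝v) (Edge-sym u~w) (here u∈R)

  walk-map : ∀ {R R'} (f : Fin n → Fin n) → (∀ {v} → v ∈ R → f v ∈ R') →
             (∀ {u w} → Edge G u w → Edge G (f u) (f w)) →
             ∀ {u v} → Walk G R u v → Walk G R' (f u) (f v)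
  walk-map f f-into f-edge (here v∈R) = here (f-into v∈R)
  walk-map f f-into f-edge (step u∈R u~w w⇝v) =
    step (f-into u∈R) (f-edge u~w) (walk-map f f-into f-edge w⇝v)

  hub⇒connected : ∀ {R} (h : Fin n) → (∀ {u} → u ∈ R → Walk G R u h) → Connected G R
  hub⇒connected h to-hub u v u∈R v∈R = to-hub u∈R ++ʷ walk-reverse (to-hub v∈R)

  Closed : Subset n → Subset n → Set
  Closed S R = ∀ {u w} → u ∈ R → w ∈ S → Edge G u w → w ∈ R

  closed-walk : ∀ {S R R'} → Closed S R → R' ⊆ S → ∀ {u v} → Walk G R' u v → u ∈ R → v ∈ R
  closed-walk R-closed R'⊆S (here _) u∈R = u∈R
  closed-walk R-closed R'⊆S (step _ u~w w⇝v) u∈R =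
    closed-walk R-closed R'⊆S w⇝v (R-closed u∈R (R'⊆S (walk-start w⇝v)) u~w)

  -- Components are exactly the nonempty, connected, closed subsets of S:
  -- a component absorbs any neighbour w ∈ S, since R ∪ {w} is connected.
  component⇒closed : ∀ {S R} → IsComponent G S R → Closed S R
  component⇒closed {S} {R} (R⊆S , _ , R-connected , R-maximal) {u} {w} u∈R w∈S u~w =
    R-maximal (R ∪ ⁅ w ⁆) R⊆R+w R+w⊆S R+w-connected w∈R+w
    where
    R⊆R+w : R ⊆ R ∪ ⁅ w ⁆
    R⊆R+w x∈R = x∈p∪q⁺ (inj₁ x∈R)
    w∈R+w : w ∈ R ∪ ⁅ w ⁆
    w∈R+w = x∈p∪q⁺ (inj₂ (x∈⁅x⁆ w))
    R+w⊆S : R ∪ ⁅ w ⁆ ⊆ S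
    R+w⊆S x∈ with x∈p∪q⁻ R ⁅ w ⁆ x∈
    ... | inj₁ x∈R = R⊆S x∈R
    ... | inj₂ x∈w rewrite x∈⁅y⁆⇒x≡y w x∈w = w∈S
    to-u : ∀ {x} → x ∈ R ∪ ⁅ w ⁆ → Walk G (R ∪ ⁅ w ⁆) x u
    to-u x∈ with x∈p∪q⁻ R ⁅ w ⁆ x∈
    ... | inj₁ x∈R = walk-mono R⊆R+w (R-connected _ u x∈R u∈R)
    ... | inj₂ x∈w rewrite x∈⁅y⁆⇒x≡y w x∈w = step w∈R+w (Edge-sym u~w) (here (R⊆R+w u∈R))
    R+w-connected : Connected G (R ∪ ⁅ w ⁆)
    R+w-connected = hub⇒connected u to-u

  -- Conversely, a walk from inside a closed set stays inside it (maximality).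
  closed⇒component : ∀ {S R} → R ⊆ S → Nonempty R → Connected G R → Closed S R →
                     IsComponent G S R
  closed⇒component R⊆S (r , r∈R) R-connected R-closed =
    R⊆S , (r , r∈R) , R-connected ,
    λ R' R⊆R' R'⊆S R'-connected v∈R' →
      closed-walk R-closed R'⊆S (R'-connected r _ (R⊆R' r∈R) v∈R') r∈R

  EvenComponents : Subset n → Subset n → Set
  EvenComponents S T = ∀ R → IsComponent G S R → 2 ∣ ∣ R ∩ T ∣

  -- Under EvenComponents S T a terminal in S is not isolated in G[S]:
  -- otherwise {z} would be a component with exactly one terminal.
  terminal-has-neighbour : ∀ {S T z} → EvenComponents S T → z ∈ S → z ∈ T →
                           ∃ λ w → w ∈ S × Edge G z w
  terminal-has-neighbour {S} {T} {z} even z∈S z∈T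
    with any? (λ w → (w ∈? S) ×-dec (adj G z w Bool.≟ true))
  ... | yes neighbour = neighbour
  ... | no isolated = ⊥-elim (2≢1 (∣1⇒≡1 (subst (2 ∣_) one-terminal (even ⁅ z ⁆ singleton))))
    where
    2≢1 : ¬ (2 ≡ 1)
    2≢1 ()
    one-terminal : ∣ ⁅ z ⁆ ∩ T ∣ ≡ 1
    one-terminal = trans (cong ∣_∣ (trans (∩-comm ⁅ z ⁆ T) (q⊆p⇒p∩q≡q z⊆T))) (∣⁅x⁆∣≡1 z)
      where
      z⊆T : ⁅ z ⁆ ⊆ T
      z⊆T x∈z rewrite x∈⁅y⁆⇒x≡y z x∈z = z∈T
    singleton : IsComponent G S ⁅ z ⁆
    singleton = closed⇒component z⊆S (z , x∈⁅x⁆ z) (hub⇒connected z to-z) z-closed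
      where
      z⊆S : ⁅ z ⁆ ⊆ S
      z⊆S x∈z rewrite x∈⁅y⁆⇒x≡y z x∈z = z∈S
      to-z : ∀ {u} → u ∈ ⁅ z ⁆ → Walk G ⁅ z ⁆ u z
      to-z u∈z rewrite x∈⁅y⁆⇒x≡y z u∈z = here (x∈⁅x⁆ z)
      z-closed : Closed S ⁅ z ⁆
      z-closed {w = w} u∈z w∈S u~w rewrite x∈⁅y⁆⇒x≡y z u∈z = ⊥-elim (isolated (w , w∈S , u~w))

  twin-edge : ∀ {d y w} → SameNbhd G d y → Edge G d w → Edge G y w
  twin-edge {d} {y} {w} d≈y d~w = trans (sym (d≈y w)) d~w

  -- A vertex is never adjacent to its twin (G is loopless).
  twin-nonadjacent : ∀ {d y} → SameNbhd G d y → ¬ Edge G y d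
  twin-nonadjacent {d} {y} d≈y y~d with trans (sym (adj-irrefl G y)) (twin-edge d≈y (Edge-sym y~d))
  ... | ()

module TwinRemoval {n : ℕ} (G : Graph n) (S D : Subset n) (y c : Fin n)
  (D-twins : ∀ {d} → d ∈ D → SameNbhd G d y)
  (D⊆S : D ⊆ S) (y∈S : y ∈ S) (y∉D : y ∉ D) (c∈S : c ∈ S) (y~c : Edge G y c) where

  open GraphFacts G

  c∉D : c ∉ D
  c∉D c∈D = twin-nonadjacent (D-twins c∈D) y~c

  D~c : ∀ {d} → d ∈ D → Edge G d c
  D~c d∈D = trans (D-twins d∈D c) y~c

  y∈S─D : y ∈ S ─ D
  y∈S─D = x∈p∧x∉q⇒x∈p─q y∈S y∉D

  c∈S─D : c ∈ S ─ D
  c∈S─D = x∈p∧x∉q⇒x∈p─q c∈S c∉D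

  -- Identifying every vertex of D with y is a graph homomorphism, since
  -- twins have the same neighbours and are pairwise non-adjacent.
  collapse : Fin n → Fin n
  collapse v with v ∈? D
  ... | yes _ = y
  ... | no _ = v

  collapse-outside : ∀ {v} → v ∉ D → collapse v ≡ v
  collapse-outside {v} v∉D with v ∈? D
  ... | yes v∈D = ⊥-elim (v∉D v∈D)
  ... | no _ = refl

  collapse-edge : ∀ {u w} → Edge G u w → Edge G (collapse u) (collapse w)
  collapse-edge {u} {w} u~w with u ∈? D | w ∈? D
  ... | yes u∈D | yes w∈D = ⊥-elim (twin-nonadjacent (D-twins w∈D) (twin-edge (D-twins u∈D) u~w))
  ... | yes u∈D | no _ = twin-edge (D-twins u∈D) u~w
  ... | no _ | yes w∈D = Edge-sym (twin-edge (D-twins w∈D) (Edge-sym u~w))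
  ... | no _ | no _ = u~w

  -- A component R of G[S] meets D only through the common neighbour c:
  -- either R ∩ D is empty or D ⊆ R, and then also c, y ∈ R.
  module Component {R : Subset n} (R-component : IsComponent G S R) where

    R-closed : Closed S R
    R-closed = component⇒closed R-component

    c∈R⇒D⊆R : c ∈ R → D ⊆ R
    c∈R⇒D⊆R c∈R d∈D = R-closed c∈R (D⊆S d∈D) (Edge-sym (D~c d∈D))

    d∈R⇒y∈R : ∀ {d} → d ∈ D → d ∈ R → y ∈ R
    d∈R⇒y∈R d∈D d∈R = R-closed (R-closed d∈R c∈S (D~c d∈D)) y∈S (Edge-sym y~c)

    trace-even : 2 ∣ ∣ D ∣ → 2 ∣ ∣ R ∩ D ∣
    trace-even even-D with c ∈? R
    ... | yes c∈R = subst (2 ∣_) (cong ∣_∣ (sym (q⊆p⇒p∩q≡q (c∈R⇒D⊆R c∈R)))) even-D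
    ... | no c∉R = divides 0 (trans (cong ∣_∣ (Empty-unique R∩D-empty)) (∣⊥∣≡0 n))
      where
      R∩D-empty : Empty (R ∩ D)
      R∩D-empty (d , d∈R∩D) with x∈p∩q⁻ R D d∈R∩D
      ... | d∈R , d∈D = c∉R (R-closed d∈R c∈S (D~c d∈D))

    -- The collapse maps R into R ─ D (a vertex of D in R drags y into R).
    collapse-into : ∀ {v} → v ∈ R → collapse v ∈ R ─ D
    collapse-into {v} v∈R with v ∈? D
    ... | yes v∈D = x∈p∧x∉q⇒x∈p─q (d∈R⇒y∈R v∈D v∈R) y∉D
    ... | no v∉D = x∈p∧x∉q⇒x∈p─q v∈R v∉D

    restrict : IsComponent G (S ─ D) (R ─ D)
    restrict = closed⇒component sub nonempty connected closed
      where
      R⊆S : R ⊆ S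
      R⊆S = proj₁ R-component
      sub : R ─ D ⊆ S ─ D
      sub v∈ with x∈p─q⁻ R D v∈
      ... | v∈R , v∉D = x∈p∧x∉q⇒x∈p─q (R⊆S v∈R) v∉D
      nonempty : Nonempty (R ─ D)
      nonempty with proj₁ (proj₂ R-component)
      ... | r , r∈R = collapse r , collapse-into r∈R
      connected : Connected G (R ─ D)
      connected u v u∈ v∈ with x∈p─q⁻ R D u∈ | x∈p─q⁻ R D v∈
      ... | u∈R , u∉D | v∈R , v∉D =
        subst₂ (Walk G (R ─ D)) (collapse-outside u∉D) (collapse-outside v∉D)
          (walk-map collapse collapse-into collapse-edge
            (proj₁ (proj₂ (proj₂ R-component)) u v u∈R v∈R))
      closed : Closed (S ─ D) (R ─ D)
      closed u∈ w∈ u~w with x∈p─q⁻ S D w∈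
      ... | w∈S , w∉D =
        x∈p∧x∉q⇒x∈p─q (R-closed (proj₁ (x∈p─q⁻ R D u∈)) w∈S u~w) w∉D

  -- A component R' of G[S ─ D] is disjoint from D; it absorbs D exactly
  -- when it contains y.
  module ReducedComponent {R' : Subset n} (R'-component : IsComponent G (S ─ D) R') where

    R'-closed : Closed (S ─ D) R'
    R'-closed = component⇒closed R'-component

    R'⊆S : R' ⊆ S
    R'⊆S v∈R' = proj₁ (x∈p─q⁻ S D (proj₁ R'-component v∈R'))

    R'∩D≡∅ : ∀ {v} → v ∈ R' → v ∉ D
    R'∩D≡∅ v∈R' = proj₂ (x∈p─q⁻ S D (proj₁ R'-component v∈R'))

    R'-connected : Connected G R'
    R'-connected = proj₁ (proj₂ (proj₂ R'-component))

    -- If y ∈ R' then R' ∪ D is a component of G[S]: everything reaches c,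
    -- and an edge leaving R' ∪ D from D would also leave R' from y.
    absorb : y ∈ R' → IsComponent G S (R' ∪ D)
    absorb y∈R' = closed⇒component sub (y , x∈p∪q⁺ (inj₁ y∈R')) (hub⇒connected c to-c) closed
      where
      R'⊆R : R' ⊆ R' ∪ D
      R'⊆R v∈R' = x∈p∪q⁺ (inj₁ v∈R')
      c∈R' : c ∈ R'
      c∈R' = R'-closed y∈R' c∈S─D y~c
      sub : R' ∪ D ⊆ S
      sub v∈ with x∈p∪q⁻ R' D v∈
      ... | inj₁ v∈R' = R'⊆S v∈R'
      ... | inj₂ v∈D = D⊆S v∈D
      to-c : ∀ {v} → v ∈ R' ∪ D → Walk G (R' ∪ D) v c
      to-c v∈ with x∈p∪q⁻ R' D v∈
      ... | inj₁ v∈R' = walk-mono R'⊆R (R'-connected _ c v∈R' c∈R')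
      ... | inj₂ v∈D = step v∈ (D~c v∈D) (here (R'⊆R c∈R'))
      closed : Closed S (R' ∪ D)
      closed {u} {w} u∈ w∈S u~w with w ∈? D | x∈p∪q⁻ R' D u∈
      ... | yes w∈D | _ = x∈p∪q⁺ (inj₂ w∈D)
      ... | no w∉D | inj₁ u∈R' = R'⊆R (R'-closed u∈R' (x∈p∧x∉q⇒x∈p─q w∈S w∉D) u~w)
      ... | no w∉D | inj₂ u∈D =
        R'⊆R (R'-closed y∈R' (x∈p∧x∉q⇒x∈p─q w∈S w∉D) (twin-edge (D-twins u∈D) u~w))

    -- If y ∉ R' then R' itself is a component of G[S]: an edge from R' into D
    -- would, by twinning, be an edge from R' to y.
    stay : y ∉ R' → IsComponent G S R'
    stay y∉R' = closed⇒component R'⊆S (proj₁ (proj₂ R'-component)) R'-connected closed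
      where
      closed : Closed S R'
      closed {u} {w} u∈R' w∈S u~w with w ∈? D
      ... | yes w∈D = ⊥-elim (y∉R' (R'-closed u∈R' y∈S─D u~y))
        where
        u~y : Edge G u y
        u~y = Edge-sym (twin-edge (D-twins w∈D) (Edge-sym u~w))
      ... | no w∉D = R'-closed u∈R' (x∈p∧x∉q⇒x∈p─q w∈S w∉D) u~w

    lift : ∃ λ R → IsComponent G S R × R ─ D ≡ R'
    lift with y ∈? R'
    ... | yes y∈R' = R' ∪ D , absorb y∈R' , trans ([p∪q]─q≡p─q R' D) (disjoint⇒p─q≡p R'∩D≡∅)
    ... | no y∉R' = R' , stay y∉R' , disjoint⇒p─q≡p R'∩D≡∅

  -- Parity transfers in both directions, since
  -- |R ∩ T| = |R ∩ D| + |(R ─ D) ∩ (T ─ D)| and |R ∩ D| is even.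
  module _ {T : Subset n} (D⊆T : D ⊆ T) (even-D : 2 ∣ ∣ D ∣) where

    even-restrict : EvenComponents S T → EvenComponents (S ─ D) (T ─ D)
    even-restrict even R' R'-component with ReducedComponent.lift R'-component
    ... | R , R-component , refl =
      ∣m+n∣m⇒∣n (subst (2 ∣_) (terminals-split R T D D⊆T) (even R R-component))
                (Component.trace-even R-component even-D)

    even-extend : EvenComponents (S ─ D) (T ─ D) → EvenComponents S T
    even-extend even' R R-component =
      subst (2 ∣_) (sym (terminals-split R T D D⊆T))
        (∣m∣n⇒∣m+n (Component.trace-even R-component even-D)
                   (even' (R ─ D) (Component.restrict R-component)))

open GraphFacts using (EvenComponents)

-- The common
-- neighbour c is supplied by terminal-has-neighbour in either direction.
twin-reduction : ∀ {n} (G : Graph n) {S T D : Subset n} {y : Fin n} →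
  (∀ {d} → d ∈ D → SameNbhd G d y) → D ⊆ S → D ⊆ T → y ∈ S → y ∈ T → y ∉ D →
  2 ∣ ∣ D ∣ → EvenComponents G (S ─ D) (T ─ D) ⇔ EvenComponents G S T
twin-reduction G {S} {T} {D} {y} D-twins D⊆S D⊆T y∈S y∈T y∉D even-D = mk⇔ extend restrict
  where
  open GraphFacts G using (terminal-has-neighbour)
  restrict : EvenComponents G S T → EvenComponents G (S ─ D) (T ─ D)
  restrict even with terminal-has-neighbour even y∈S y∈T
  ... | c , c∈S , y~c =
    TwinRemoval.even-restrict G S D y c D-twins D⊆S y∈S y∉D c∈S y~c D⊆T even-D even
  extend : EvenComponents G (S ─ D) (T ─ D) → EvenComponents G S T
  extend even' with terminal-has-neighbour even' (x∈p∧x∉q⇒x∈p─q y∈S y∉D)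
                                                 (x∈p∧x∉q⇒x∈p─q y∈T y∉D)
  ... | c , c∈S─D , y~c =
    TwinRemoval.even-extend G S D y c D-twins D⊆S y∈S y∉D (p─q⊆p S D c∈S─D) y~c D⊆T even-D even'

removed-even : ∀ {n} {X Y : Subset n} → Y ⊆ X → ∣ Y ∣ ≡ keepCount ∣ X ∣ → 2 ∣ ∣ X ─ Y ∣
removed-even {X = X} {Y} Y⊆X ∣Y∣≡ = keepCount-complement-even ∣ X ∣ ∣ X ─ Y ∣ (begin
  ∣ X ∣                      ≡⟨ ∣p∣≡∣p∩q∣+∣p─q∣ X Y ⟩
  ∣ X ∩ Y ∣ + ∣ X ─ Y ∣      ≡⟨ cong (λ P → ∣ P ∣ + ∣ X ─ Y ∣) (q⊆p⇒p∩q≡q Y⊆X) ⟩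
  ∣ Y ∣ + ∣ X ─ Y ∣          ≡⟨ cong (_+ ∣ X ─ Y ∣) ∣Y∣≡ ⟩
  keepCount ∣ X ∣ + ∣ X ─ Y ∣ ∎)
  where open ≡-Reasoning

nothing-removed : ∀ {n} {X Y : Subset n} → Empty Y → ∣ Y ∣ ≡ keepCount ∣ X ∣ → X ─ Y ≡ ⊥
nothing-removed {n} {X} {Y} Y-empty ∣Y∣≡ =
  Empty-unique λ (x , x∈X─Y) → X-empty (x , p─q⊆p X Y x∈X─Y)
  where
  X-empty : Empty X
  X-empty = ∣p∣≡0⇒Empty X (keepCount≡0⇒≡0 ∣ X ∣
    (trans (sym ∣Y∣≡) (trans (cong ∣_∣ (Empty-unique Y-empty)) (∣⊥∣≡0 n))))

transfer-solution : ∀ {n} (G : Graph n) {A A' B T T' : Subset n} {k : ℕ} →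
  (∀ {C} → C ⊆ B → EvenComponents G (C ∪ A) T → EvenComponents G (C ∪ A') T') →
  HasSolution G A B T k → HasSolution G A' B T' k
transfer-solution G parity (C , C⊆B , ∣C∣≤k , even) = C , C⊆B , ∣C∣≤k , parity C⊆B even

remove-nothing : ∀ {n} (G : Graph n) {A B T D : Subset n} {k : ℕ} → D ≡ ⊥ →
  HasSolution G (A ─ D) B (T ─ D) k ⇔ HasSolution G A B T k
remove-nothing G {A} {T = T} refl rewrite p─⊥≡p A | p─⊥≡p T = mk⇔ id id

-- For a candidate C ⊆ B, deleting from A and T an even set D ⊆ T of twins of a
-- terminal y ∉ D leaves the parity condition unchanged: D ⊆ A is disjoint from
-- C ⊆ B, so G[C ∪ (A ─ D)] is G[C ∪ A] with D deleted, and twin-reduction applies.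
instance-twin-reduction : ∀ {n} (G : Graph n) {A B T D C : Subset n} {y : Fin n} →
  IsInstance G A B T → (∀ {d} → d ∈ D → SameNbhd G d y) → D ⊆ T → y ∈ T → y ∉ D →
  2 ∣ ∣ D ∣ → C ⊆ B → EvenComponents G (C ∪ (A ─ D)) (T ─ D) ⇔ EvenComponents G (C ∪ A) T
instance-twin-reduction G {A} {D = D} {C} (_ , A∩B≡∅ , _ , _ , _ , T⊆A) D-twins D⊆T y∈T y∉D even-D C⊆B
  rewrite disjoint⇒p∪[q─r]≡[p∪q]─r {p = C} {A} {D}
            (λ x∈C x∈D → A∩B≡∅ _ (T⊆A (D⊆T x∈D)) (C⊆B x∈C)) =
  twin-reduction G D-twins (λ d∈D → x∈p∪q⁺ (inj₂ (T⊆A (D⊆T d∈D)))) D⊆T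
    (x∈p∪q⁺ (inj₂ (T⊆A y∈T))) y∈T y∉D even-D

lemma4p5 : ∀ {n : ℕ} (G : Graph n) (A B T : Subset n) (k : ℕ) →
    IsInstance G A B T →
    (X : Subset n) → MaximalTwinSet G T X →
    (Y : Subset n) → Y ⊆ X → ∣ Y ∣ ≡ keepCount ∣ X ∣ →
    HasSolution G (A ─ (X ─ Y)) B (T ─ (X ─ Y)) k ⇔ HasSolution G A B T k
lemma4p5 G A B T k inst X (X⊆T , X-twins , _) Y Y⊆X ∣Y∣≡ with nonempty? Y
... | no Y-empty = remove-nothing G (nothing-removed Y-empty ∣Y∣≡)
... | yes (y , y∈Y) = mk⇔ (transfer-solution G (Equivalence.to ∘ parity))
                          (transfer-solution G (Equivalence.from ∘ parity))
  where
  D⊆X : X ─ Y ⊆ X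
  D⊆X = p─q⊆p X Y
  parity : ∀ {C} → C ⊆ B →
    EvenComponents G (C ∪ (A ─ (X ─ Y))) (T ─ (X ─ Y)) ⇔ EvenComponents G (C ∪ A) T
  parity = instance-twin-reduction G inst (λ d∈D → X-twins _ y (D⊆X d∈D) (Y⊆X y∈Y))
    (λ d∈D → X⊆T (D⊆X d∈D)) (X⊆T (Y⊆X y∈Y)) (λ y∈D → proj₂ (x∈p─q⁻ X Y y∈D) y∈Y)
    (removed-even Y⊆X ∣Y∣≡)
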